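{- Let $G=K_n$ be the complete graph of order $n\geq 3$, let $G_1,G_2$ be disjoint copies of $G$ with $A=V(G_1)$, $B=V(G_2)$, let $g:A\to B$ be a function, let $I=g(A)$ and $s=|I|$ with $2<s<n$. If $|g^{ -1}(v)|=\frac{n}{s}$ for all $v\in I$, then $fix(F_G)=2(n-s)-1$.
   Context: A set $S\subseteq V(H)$ is a fixing set of a graph $H$ if the only automorphism of $H$ fixing every vertex of $S$ is the identity; $fix(H)$ is the minimum cardinality of a fixing set of $H$. Functigraph: for disjoint copies $G_1,G_2$ of $G$, $A=V(G_1)$, $B=V(G_2)$ and a function $g:A\to B$, $F_G$ is the graph with vertex set $A\cup B$ and edge set $E(G_1)\cup E(G_2)\cup\{uv:u\in A,\ v=g(u)\}$. -}

module Defs where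

open import Level using (0ℓ)
open import Data.Nat using (ℕ; _≤_)
open import Data.Fin using (Fin; _≟_)
open import Data.Fin.Properties using (any?)
open import Data.Sum using (_⊎_; inj₁; inj₂)
open import Data.Product using (Σ; ∃; _×_)
open import Data.List using (List; length; filter; allFin)
open import Data.List.Membership.Propositional using (_∈_)
open import Data.List.Relation.Unary.Unique.Propositional using (Unique)
open import Relation.Binary.PropositionalEquality using (_≡_; _≢_)
open import Function.Bundles using (_↔_; Inverse; _⇔_)

record Graph : Set₁ where
  field
    V   : Set
    Adj : V → V → Set
open Graph public

record Automorphism (H : Graph) : Set where
  field
    perm     : V H ↔ V H
    preserve : ∀ u v → Adj H u v ⇔ Adj H (Inverse.to perm u) (Inverse.to perm v)
open Automorphism public

aut : {H : Graph} → Automorphism H → V H → V H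
aut σ = Inverse.to (perm σ)

IsFixingSet : (H : Graph) → List (V H) → Set
IsFixingSet H S = (σ : Automorphism H) → (∀ v → v ∈ S → aut σ v ≡ v) → ∀ v → aut σ v ≡ v

FixingNumber : (H : Graph) → ℕ → Set
FixingNumber H k =
  (Σ (List (V H)) λ S → Unique S × length S ≡ k × IsFixingSet H S)
  × (∀ S → Unique S → IsFixingSet H S → k ≤ length S)

-- Functigraph of K_n: A = inj₁ copy, B = inj₂ copy of Fin n.
FunctigraphK : (n : ℕ) → (Fin n → Fin n) → Graph
FunctigraphK n g = record { V = Fin n ⊎ Fin n ; Adj = adj }
  where
  adj : Fin n ⊎ Fin n → Fin n ⊎ Fin n → Set
  adj (inj₁ a) (inj₁ b) = a ≢ b
  adj (inj₂ a) (inj₂ b) = a ≢ b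
  adj (inj₁ a) (inj₂ b) = g a ≡ b
  adj (inj₂ b) (inj₁ a) = g a ≡ b

preimageSize : {n : ℕ} → (Fin n → Fin n) → Fin n → ℕ
preimageSize {n} g b = length (filter (λ a → g a ≟ b) (allFin n))

imageSize : {n : ℕ} → (Fin n → Fin n) → ℕ
imageSize {n} g = length (filter (λ b → any? (λ a → g a ≟ b)) (allFin n))

-- Two vertices of A with the same image under g are twins, and so are two vertices of
-- B ∖ g(A); transposing twins is an automorphism, so a fixing set omits at most one vertex
-- of each fibre, at most one vertex of B ∖ g(A), and at most the s vertices of g(A),
-- whence |S| ≥ 2n − (2s + 1).  Conversely, omit one representative of each fibre, all of
-- g(A), and one point c ∉ g(A).  Every fibre has n/s ≥ 2 points, so it keeps a vertex fixed
-- by the automorphism; that vertex pins down its image in B, the image points then pin down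
-- the representatives, and c is the only vertex left.
module Submission where

open import Defs
open import Data.Nat using (ℕ; suc; _+_; _≤_; _<_; _*_; _∸_; z≤n; s≤s)
open import Data.Nat.Properties
  using ( ≤-antisym; <⇒≤; <-irrefl; +-suc; +-identityʳ; +-monoʳ-≤; +-cancelʳ-≡; +-cancelʳ-≤
        ; +-∸-assoc; m+n∸m≡n; m≤m+n; m≤n⇒∃[o]m+o≡n; module ≤-Reasoning)
open import Data.Nat.Tactic.RingSolver using (solve-∀)
open import Data.Fin using (Fin) renaming (_≟_ to _≟ᶠ_)
open import Data.Fin.Properties using (any?; ¬∀⟶∃¬)
open import Data.Sum as Sum using (_⊎_; inj₁; inj₂)
open import Data.Sum.Properties using (inj₁-injective; inj₂-injective; ≡-dec)
open import Data.Maybe using (Maybe; just; nothing)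
open import Data.Maybe.Properties using (just-injective)
open import Data.Product using (∃; _×_; _,_; proj₁; proj₂)
open import Data.Empty using (⊥; ⊥-elim)
open import Data.List using (List; []; _∷_; _++_; length; map; filter; allFin)
open import Data.List.Properties using (length-++; length-map; length-tabulate; filter-all)
open import Data.List.Membership.Propositional using (_∈_; _∉_)
open import Data.List.Membership.Propositional.Properties
  using (∈-∃++; ∈-++⁺ˡ; ∈-++⁺ʳ; ∈-++⁻; ∈-map⁺; ∈-map⁻; ∈-filter⁺; ∈-filter⁻; ∈-allFin)
open import Data.List.Relation.Binary.Subset.Propositional using (_⊆_)
open import Data.List.Relation.Unary.Any using (here; there)
import Data.List.Relation.Unary.All as All
open import Data.List.Relation.Unary.All.Properties using () renaming (map⁺ to All-map⁺)
open import Data.List.Relation.Unary.AllPairs using ([]; _∷_)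
open import Data.List.Relation.Unary.Unique.Propositional using (Unique)
open import Data.List.Relation.Unary.Unique.Propositional.Properties
  using (filter⁺; allFin⁺; ++⁺) renaming (map⁺ to Unique-map⁺)
open import Function using (_∘_; id)
open import Function.Bundles using (Injection; _⇔_; mk⇔; mk↔ₛ′; Equivalence)
open import Function.Properties.Inverse using (↔⇒↣)
open import Function.Construct.Symmetry using (⇔-sym)
open import Relation.Binary.Definitions using (DecidableEquality)
open import Relation.Binary.PropositionalEquality
  using (_≡_; _≢_; refl; sym; trans; cong; cong₂; subst; subst₂)
open import Relation.Nullary using (¬_; Dec; yes; no)

module _ {A : Set} where

  Unique⇒length≤ : ∀ {xs ys : List A} → Unique xs → xs ⊆ ys → length xs ≤ length ys
  Unique⇒length≤ {[]} _ _ = z≤n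
  Unique⇒length≤ {x ∷ xs} {ys} (x∉xs ∷ xs!) x∷xs⊆ys with ∈-∃++ (x∷xs⊆ys (here refl))
  ... | l , r , refl = begin
    suc (length xs)           ≤⟨ s≤s (Unique⇒length≤ xs! xs⊆l++r) ⟩
    suc (length (l ++ r))     ≡⟨ cong suc (length-++ l) ⟩
    suc (length l + length r) ≡⟨ +-suc (length l) (length r) ⟨
    length l + length (x ∷ r) ≡⟨ length-++ l ⟨
    length (l ++ x ∷ r)       ∎
    where
    open ≤-Reasoning
    xs⊆l++r : xs ⊆ l ++ r
    xs⊆l++r y∈xs with ∈-++⁻ l (x∷xs⊆ys (there y∈xs))
    ... | inj₁ y∈l         = ∈-++⁺ˡ y∈l
    ... | inj₂ (here refl) = ⊥-elim (All.lookup x∉xs y∈xs refl)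
    ... | inj₂ (there y∈r) = ∈-++⁺ʳ l y∈r

  map⁺-injectiveOn : ∀ {B : Set} {f : A → B} {xs} →
                     (∀ {x y} → x ∈ xs → y ∈ xs → f x ≡ f y → x ≡ y) →
                     Unique xs → Unique (map f xs)
  map⁺-injectiveOn f-inj [] = []
  map⁺-injectiveOn f-inj (x∉xs ∷ xs!) =
    All-map⁺ (All.tabulate λ y∈xs fx≡fy →
                All.lookup x∉xs y∈xs (f-inj (here refl) (there y∈xs) fx≡fy))
    ∷ map⁺-injectiveOn (λ x∈ y∈ → f-inj (there x∈) (there y∈)) xs!

  otherMember : DecidableEquality A → ∀ {xs} → Unique xs → 2 ≤ length xs →
                ∀ z → ∃ λ y → y ∈ xs × y ≢ z
  otherMember _ {[]}     _ ()
  otherMember _ {_ ∷ []} _ (s≤s ())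
  otherMember _≟_ {x ∷ y ∷ _} ((x≢y All.∷ _) ∷ _) _ z with x ≟ z
  ... | yes refl = y , there (here refl) , x≢y ∘ sym
  ... | no x≢z   = x , here refl , x≢z

length-allFin : ∀ n → length (allFin n) ≡ n
length-allFin n = length-tabulate {n = n} id

n<m*n⇒2≤m : ∀ m n → n < m * n → 2 ≤ m
n<m*n⇒2≤m 0             n ()
n<m*n⇒2≤m 1             n n<n+0 = ⊥-elim (<-irrefl (sym (+-identityʳ n)) n<n+0)
n<m*n⇒2≤m (suc (suc m)) n _     = s≤s (s≤s z≤n)

2*[n∸s]∸1+[s+1+s]≡n+n : ∀ {s n} → s < n → 2 * (n ∸ s) ∸ 1 + (s + suc s) ≡ n + n
2*[n∸s]∸1+[s+1+s]≡n+n {s} s<n with m≤n⇒∃[o]m+o≡n s<n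
... | o , refl rewrite +-∸-assoc 1 (m≤m+n s o) | m+n∸m≡n s o = semiring-identity s o
  where
  semiring-identity : ∀ s o → o + (suc o + 0) + (s + suc s) ≡ suc s + o + (suc s + o)
  semiring-identity = solve-∀

module _ {H : Graph} (σ : Automorphism H) where

  aut-injective : ∀ {u v} → aut σ u ≡ aut σ v → u ≡ v
  aut-injective = Injection.injective (↔⇒↣ (perm σ))

  Adj-transport : ∀ {u v u′ v′} → aut σ u ≡ u′ → aut σ v ≡ v′ →
                  Adj H u v ⇔ Adj H u′ v′
  Adj-transport refl refl = preserve σ _ _

  fixesAllButOne⇒fixesAll : DecidableEquality (V H) → ∀ x →
                            (∀ v → v ≢ x → aut σ v ≡ v) → ∀ v → aut σ v ≡ v
  fixesAllButOne⇒fixesAll _≟_ x fixes v with v ≟ x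
  ... | no v≢x = fixes v v≢x
  ... | yes refl with aut σ x ≟ x
  ...   | yes σx≡x = σx≡x
  ...   | no σx≢x  = aut-injective (fixes (aut σ x) σx≢x)

record Twins (H : Graph) (x y : V H) : Set where
  field
    out-adj  : ∀ w → w ≢ x → w ≢ y → Adj H x w ⇔ Adj H y w
    in-adj   : ∀ w → w ≢ x → w ≢ y → Adj H w x ⇔ Adj H w y
    adj-swap : Adj H x y ⇔ Adj H y x
    adj-loop : Adj H x x ⇔ Adj H y y

module Transposition {H : Graph} (_≟_ : DecidableEquality (V H))
                     {x y : V H} (x≢y : x ≢ y) where

  data Position (z : V H) : Set where
    is-x  : z ≡ x → Position z
    is-y  : z ≡ y → Position z
    other : z ≢ x → z ≢ y → Position z

  position : ∀ z → Position z
  position z with z ≟ x | z ≟ y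
  ... | yes z≡x | _       = is-x z≡x
  ... | no _    | yes z≡y = is-y z≡y
  ... | no z≢x  | no z≢y  = other z≢x z≢y

  swap : V H → V H
  swap z with z ≟ x | z ≟ y
  ... | yes _ | _     = y
  ... | no _  | yes _ = x
  ... | no _  | no _  = z

  swap-x : swap x ≡ y
  swap-x with x ≟ x
  ... | yes _  = refl
  ... | no x≢x = ⊥-elim (x≢x refl)

  swap-y : swap y ≡ x
  swap-y with y ≟ x | y ≟ y
  ... | yes y≡x | _      = ⊥-elim (x≢y (sym y≡x))
  ... | no _    | yes _  = refl
  ... | no _    | no y≢y = ⊥-elim (y≢y refl)

  swap-other : ∀ {z} → z ≢ x → z ≢ y → swap z ≡ z
  swap-other {z} z≢x z≢y with z ≟ x | z ≟ y
  ... | yes z≡x | _       = ⊥-elim (z≢x z≡x)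
  ... | no _    | yes z≡y = ⊥-elim (z≢y z≡y)
  ... | no _    | no _    = refl

  swap-involutive : ∀ z → swap (swap z) ≡ z
  swap-involutive z with position z
  ... | is-x refl rewrite swap-x = swap-y
  ... | is-y refl rewrite swap-y = swap-x
  ... | other z≢x z≢y rewrite swap-other z≢x z≢y = swap-other z≢x z≢y

  module _ (twins : Twins H x y) where
    open Twins twins

    swap-preserves : ∀ u v → Adj H u v ⇔ Adj H (swap u) (swap v)
    swap-preserves u v with position u | position v
    ... | is-x refl | is-x refl rewrite swap-x = adj-loop
    ... | is-x refl | is-y refl rewrite swap-x | swap-y = adj-swap
    ... | is-y refl | is-x refl rewrite swap-x | swap-y = ⇔-sym adj-swap
    ... | is-y refl | is-y refl rewrite swap-y = ⇔-sym adj-loop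
    ... | is-x refl | other v≢x v≢y rewrite swap-x | swap-other v≢x v≢y =
      out-adj v v≢x v≢y
    ... | is-y refl | other v≢x v≢y rewrite swap-y | swap-other v≢x v≢y =
      ⇔-sym (out-adj v v≢x v≢y)
    ... | other u≢x u≢y | is-x refl rewrite swap-x | swap-other u≢x u≢y =
      in-adj u u≢x u≢y
    ... | other u≢x u≢y | is-y refl rewrite swap-y | swap-other u≢x u≢y =
      ⇔-sym (in-adj u u≢x u≢y)
    ... | other u≢x u≢y | other v≢x v≢y rewrite swap-other u≢x u≢y | swap-other v≢x v≢y =
      mk⇔ id id

    swapAutomorphism : Automorphism H
    swapAutomorphism = record
      { perm     = mk↔ₛ′ swap swap swap-involutive swap-involutive
      ; preserve = swap-preserves
      }

twins∩fixingSet : ∀ {H : Graph} → DecidableEquality (V H) → ∀ {x y S} →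
                  x ≢ y → Twins H x y → IsFixingSet H S → x ∉ S → y ∉ S → ⊥
twins∩fixingSet {H} _≟_ {x} {y} {S} x≢y twins S-fixing x∉S y∉S =
  x≢y (trans (sym (S-fixing σ fixes-S x)) swap-x)
  where
  open Transposition _≟_ x≢y
  σ : Automorphism H
  σ = swapAutomorphism twins
  fixes-S : ∀ v → v ∈ S → aut σ v ≡ v
  fixes-S v v∈S = swap-other (λ { refl → x∉S v∈S }) (λ { refl → y∉S v∈S })

module Counting {H : Graph} (_≟_ : DecidableEquality (V H))
                {vertices : List (V H)} (vertices! : Unique vertices)
                (∈-vertices : ∀ v → v ∈ vertices) where

  open import Data.List.Membership.DecPropositional _≟_ using (_∈?_; _∉?_)
  open ≤-Reasoning

  complement : List (V H) → List (V H)
  complement S = filter (_∉? S) vertices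

  ∈-complement⁺ : ∀ {v S} → v ∉ S → v ∈ complement S
  ∈-complement⁺ {v} {S} = ∈-filter⁺ (_∉? S) (∈-vertices v)

  ∈-complement⁻ : ∀ {v S} → v ∈ complement S → v ∉ S
  ∈-complement⁻ {S = S} = proj₂ ∘ ∈-filter⁻ (_∉? S) {xs = vertices}

  complement! : ∀ S → Unique (complement S)
  complement! S = filter⁺ (_∉? S) vertices!

  length-complement+length≤ : ∀ {R} → Unique R →
                              length (complement R) + length R ≤ length vertices
  length-complement+length≤ {R} R! = begin
    length (complement R) + length R ≡⟨ length-++ (complement R) ⟨
    length (complement R ++ R)       ≤⟨ Unique⇒length≤ complement++R! (λ {v} _ → ∈-vertices v) ⟩
    length vertices                  ∎
    where
    complement++R! : Unique (complement R ++ R)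
    complement++R! = ++⁺ (complement! R) R! λ (v∈∁R , v∈R) → ∈-complement⁻ v∈∁R v∈R

  fixingSet-length≥ : ∀ {K : Set} (class : V H → K) (classes : List K) →
                      (∀ v → class v ∈ classes) →
                      (∀ {u v} → u ≢ v → class u ≡ class v → Twins H u v) →
                      ∀ S → IsFixingSet H S → length vertices ≤ length S + length classes
  fixingSet-length≥ class classes ∈-classes class⇒twins S S-fixing = begin
    length vertices                     ≤⟨ Unique⇒length≤ vertices! vertices⊆S++∁S ⟩
    length (S ++ ∁S)                    ≡⟨ length-++ S ⟩
    length S + length ∁S                ≡⟨ cong (length S +_) (length-map class ∁S) ⟨
    length S + length (map class ∁S)    ≤⟨ +-monoʳ-≤ (length S) (Unique⇒length≤ classesOf∁S! classesOf∁S⊆) ⟩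
    length S + length classes           ∎
    where
    ∁S : List (V H)
    ∁S = complement S

    vertices⊆S++∁S : vertices ⊆ S ++ ∁S
    vertices⊆S++∁S {v} _ with v ∈? S
    ... | yes v∈S = ∈-++⁺ˡ v∈S
    ... | no v∉S  = ∈-++⁺ʳ S (∈-complement⁺ v∉S)

    class-injectiveOn-∁S : ∀ {u v} → u ∈ ∁S → v ∈ ∁S → class u ≡ class v → u ≡ v
    class-injectiveOn-∁S {u} {v} u∈∁S v∈∁S same with u ≟ v
    ... | yes u≡v = u≡v
    ... | no u≢v  = ⊥-elim (twins∩fixingSet _≟_ u≢v (class⇒twins u≢v same) S-fixing
                                             (∈-complement⁻ u∈∁S) (∈-complement⁻ v∈∁S))

    classesOf∁S! : Unique (map class ∁S)
    classesOf∁S! = map⁺-injectiveOn class-injectiveOn-∁S (complement! S)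

    classesOf∁S⊆ : map class ∁S ⊆ classes
    classesOf∁S⊆ k∈ with ∈-map⁻ class k∈
    ... | v , _ , refl = ∈-classes v

module Functigraph (n : ℕ) (g : Fin n → Fin n) where

  H : Graph
  H = FunctigraphK n g

  Vertex : Set
  Vertex = Fin n ⊎ Fin n

  _≟ᵥ_ : DecidableEquality Vertex
  _≟ᵥ_ = ≡-dec _≟ᶠ_ _≟ᶠ_

  vertices : List Vertex
  vertices = map inj₁ (allFin n) ++ map inj₂ (allFin n)

  vertices! : Unique vertices
  vertices! = ++⁺ (Unique-map⁺ inj₁-injective (allFin⁺ n))
                  (Unique-map⁺ inj₂-injective (allFin⁺ n))
                  disjoint
    where
    disjoint : ∀ {v} → ¬ (v ∈ map inj₁ (allFin n) × v ∈ map inj₂ (allFin n))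
    disjoint (v∈A , v∈B) with ∈-map⁻ inj₁ v∈A | ∈-map⁻ inj₂ v∈B
    ... | _ , _ , refl | _ , _ , ()

  ∈-vertices : ∀ v → v ∈ vertices
  ∈-vertices (inj₁ a) = ∈-++⁺ˡ (∈-map⁺ inj₁ (∈-allFin a))
  ∈-vertices (inj₂ b) = ∈-++⁺ʳ (map inj₁ (allFin n)) (∈-map⁺ inj₂ (∈-allFin b))

  length-vertices : length vertices ≡ n + n
  length-vertices = trans (length-++ (map inj₁ (allFin n)))
                          (cong₂ _+_ (length-map-allFin inj₁) (length-map-allFin inj₂))
    where
    length-map-allFin : (f : Fin n → Vertex) → length (map f (allFin n)) ≡ n
    length-map-allFin f = trans (length-map f (allFin n)) (length-allFin n)

  open Counting {H = H} _≟ᵥ_ vertices! ∈-vertices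

  InImage : Fin n → Set
  InImage b = ∃ λ a → g a ≡ b

  image : List (Fin n)
  image = filter (λ b → any? λ a → g a ≟ᶠ b) (allFin n)

  image! : Unique image
  image! = filter⁺ (λ b → any? λ a → g a ≟ᶠ b) (allFin⁺ n)

  ∈-image⁺ : ∀ {b} → InImage b → b ∈ image
  ∈-image⁺ {b} = ∈-filter⁺ (λ b → any? λ a → g a ≟ᶠ b) (∈-allFin b)

  ∈-image⁻ : ∀ {b} → b ∈ image → InImage b
  ∈-image⁻ = proj₂ ∘ ∈-filter⁻ (λ b → any? λ a → g a ≟ᶠ b) {xs = allFin n}

  fiber : Fin n → List (Fin n)
  fiber b = filter (λ a → g a ≟ᶠ b) (allFin n)

  fiber! : ∀ b → Unique (fiber b)
  fiber! b = filter⁺ (λ a → g a ≟ᶠ b) (allFin⁺ n)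

  ∈-fiber⁺ : ∀ {a b} → g a ≡ b → a ∈ fiber b
  ∈-fiber⁺ {a} {b} = ∈-filter⁺ (λ a → g a ≟ᶠ b) (∈-allFin a)

  ∈-fiber⁻ : ∀ {a b} → a ∈ fiber b → g a ≡ b
  ∈-fiber⁻ {b = b} = proj₂ ∘ ∈-filter⁻ (λ a → g a ≟ᶠ b) {xs = allFin n}

  nonImagePoint : length image < n → ∃ λ c → ¬ InImage c
  nonImagePoint s<n = ¬∀⟶∃¬ n InImage (λ b → any? λ a → g a ≟ᶠ b) not-surjective
    where
    not-surjective : ¬ (∀ b → InImage b)
    not-surjective surjective = <-irrefl length-image≡n s<n
      where
      image≡allFin : image ≡ allFin n
      image≡allFin = filter-all (λ b → any? λ a → g a ≟ᶠ b) {xs = allFin n}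
                                (All.tabulate λ {b} _ → surjective b)
      length-image≡n : length image ≡ n
      length-image≡n = trans (cong length image≡allFin) (length-allFin n)

  sameFiber⇒twins : ∀ {a a′} → g a ≡ g a′ → Twins H (inj₁ a) (inj₁ a′)
  sameFiber⇒twins {a} {a′} ga≡ga′ = record
    { out-adj  = λ { (inj₁ w) w≢a w≢a′ → mk⇔ (λ _ → w≢a′ ∘ cong inj₁ ∘ sym)
                                             (λ _ → w≢a ∘ cong inj₁ ∘ sym)
                   ; (inj₂ w) _ _       → mk⇔ (trans (sym ga≡ga′)) (trans ga≡ga′) }
    ; in-adj   = λ { (inj₁ w) w≢a w≢a′ → mk⇔ (λ _ → w≢a′ ∘ cong inj₁) (λ _ → w≢a ∘ cong inj₁)
                   ; (inj₂ w) _ _       → mk⇔ (trans (sym ga≡ga′)) (trans ga≡ga′) }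
    ; adj-swap = mk⇔ (_∘ sym) (_∘ sym)
    ; adj-loop = mk⇔ (λ a≢a → ⊥-elim (a≢a refl)) (λ a′≢a′ → ⊥-elim (a′≢a′ refl))
    }

  outsideImage⇒twins : ∀ {b b′} → ¬ InImage b → ¬ InImage b′ →
                       Twins H (inj₂ b) (inj₂ b′)
  outsideImage⇒twins {b} {b′} b∉I b′∉I = record
    { out-adj  = λ { (inj₁ w) _ _       → no-A-neighbours w
                   ; (inj₂ w) w≢b w≢b′ → mk⇔ (λ _ → w≢b′ ∘ cong inj₂ ∘ sym)
                                             (λ _ → w≢b ∘ cong inj₂ ∘ sym) }
    ; in-adj   = λ { (inj₁ w) _ _       → no-A-neighbours w
                   ; (inj₂ w) w≢b w≢b′ → mk⇔ (λ _ → w≢b′ ∘ cong inj₂) (λ _ → w≢b ∘ cong inj₂) }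
    ; adj-swap = mk⇔ (_∘ sym) (_∘ sym)
    ; adj-loop = mk⇔ (λ b≢b → ⊥-elim (b≢b refl)) (λ b′≢b′ → ⊥-elim (b′≢b′ refl))
    }
    where
    no-A-neighbours : ∀ w → g w ≡ b ⇔ g w ≡ b′
    no-A-neighbours w = mk⇔ (λ gw≡b → ⊥-elim (b∉I (w , gw≡b)))
                            (λ gw≡b′ → ⊥-elim (b′∉I (w , gw≡b′)))

  -- One class per fibre in A, a singleton {b} for each b ∈ g(A), and B ∖ g(A).
  Class : Set
  Class = Fin n ⊎ Maybe (Fin n)

  imageTag : ∀ {b} → Dec (InImage b) → Maybe (Fin n)
  imageTag {b} (yes _) = just b
  imageTag     (no _)  = nothing

  class : Vertex → Class
  class (inj₁ a) = inj₁ (g a)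
  class (inj₂ b) = inj₂ (imageTag (any? λ a → g a ≟ᶠ b))

  classes : List Class
  classes = map inj₁ image ++ inj₂ nothing ∷ map (inj₂ ∘ just) image

  length-classes : length classes ≡ length image + suc (length image)
  length-classes = trans (length-++ (map inj₁ image))
                         (cong₂ _+_ (length-map inj₁ image)
                                    (cong suc (length-map (inj₂ ∘ just) image)))

  ∈-classes : ∀ v → class v ∈ classes
  ∈-classes (inj₁ a) = ∈-++⁺ˡ (∈-map⁺ inj₁ (∈-image⁺ (a , refl)))
  ∈-classes (inj₂ b) with any? (λ a → g a ≟ᶠ b)
  ... | yes b∈I = ∈-++⁺ʳ (map inj₁ image) (there (∈-map⁺ (inj₂ ∘ just) (∈-image⁺ b∈I)))
  ... | no _    = ∈-++⁺ʳ (map inj₁ image) (here refl)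

  class⇒twins : ∀ {u v} → u ≢ v → class u ≡ class v → Twins H u v
  class⇒twins {inj₁ a} {inj₁ a′} _ same = sameFiber⇒twins (inj₁-injective same)
  class⇒twins {inj₂ b} {inj₂ b′} b≢b′ same
    with any? (λ a → g a ≟ᶠ b) | any? (λ a → g a ≟ᶠ b′)
  ... | yes _  | yes _   = ⊥-elim (b≢b′ (cong inj₂ (just-injective (inj₂-injective same))))
  ... | no b∉I | no b′∉I = outsideImage⇒twins b∉I b′∉I
  ... | yes _  | no _    with () ← same
  ... | no _   | yes _   with () ← same
  class⇒twins {inj₁ _} {inj₂ _} _ ()
  class⇒twins {inj₂ _} {inj₁ _} _ ()

  fixingSet-length≥2n∸[2s+1] : ∀ S → IsFixingSet H S →
                               n + n ≤ length S + (length image + suc (length image))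
  fixingSet-length≥2n∸[2s+1] S S-fixing =
    subst₂ (λ l k → l ≤ length S + k) length-vertices length-classes
           (fixingSet-length≥ class classes ∈-classes class⇒twins S S-fixing)

  firstOr : Fin n → List (Fin n) → Vertex
  firstOr b []      = inj₂ b
  firstOr _ (a ∷ _) = inj₁ a

  -- For b outside the image the fibre is empty and this is the junk value inj₂ b.
  representative : Fin n → Vertex
  representative b = firstOr b (fiber b)

  representative-inj₁ : ∀ {a b} → inj₁ a ≡ representative b → g a ≡ b
  representative-inj₁ {a} {b} = ∈-fiber⁻ ∘ first∈ (fiber b)
    where
    first∈ : ∀ as → inj₁ a ≡ firstOr b as → a ∈ as
    first∈ (_ ∷ _) refl = here refl

  representative-image : ∀ {b} → InImage b → ∃ λ x → representative b ≡ inj₁ x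
  representative-image {b} (a , ga≡b) = first-nonempty (fiber b) (∈-fiber⁺ ga≡b)
    where
    first-nonempty : ∀ as → a ∈ as → ∃ λ x → firstOr b as ≡ inj₁ x
    first-nonempty (x ∷ _) _ = x , refl

  nonRepresentative : ∀ {b} → InImage b → 2 ≤ length (fiber b) →
                      ∃ λ y → g y ≡ b × inj₁ y ≢ representative b
  nonRepresentative {b} b∈I 2≤fiber with representative-image b∈I
  ... | x , rep≡x with otherMember _≟ᶠ_ (fiber! b) 2≤fiber x
  ...   | y , y∈fiber , y≢x =
    y , ∈-fiber⁻ y∈fiber , λ y-rep → y≢x (inj₁-injective (trans y-rep rep≡x))

  module Complement (c : Fin n) (c∉I : ¬ InImage c) where

    R : List Vertex
    R = map representative image ++ inj₂ c ∷ map inj₂ image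

    S : List Vertex
    S = complement R

    S! : Unique S
    S! = complement! R

    R! : Unique R
    R! = ++⁺ (map⁺-injectiveOn representative-injectiveOn image!)
             (Unique-map⁺ inj₂-injective (All.tabulate c≢image ∷ image!))
             disjoint
      where
      representative-injectiveOn : ∀ {b b′} → b ∈ image → b′ ∈ image →
                                   representative b ≡ representative b′ → b ≡ b′
      representative-injectiveOn b∈I _ same with representative-image (∈-image⁻ b∈I)
      ... | x , rep≡x = trans (sym (representative-inj₁ (sym rep≡x)))
                              (representative-inj₁ (trans (sym rep≡x) same))
      c≢image : ∀ {b} → b ∈ image → c ≢ b
      c≢image b∈I refl = c∉I (∈-image⁻ b∈I)
      disjoint : ∀ {v} → ¬ (v ∈ map representative image × v ∈ map inj₂ (c ∷ image))
      disjoint (v∈reps , v∈B) with ∈-map⁻ representative v∈reps | ∈-map⁻ inj₂ v∈B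
      ... | b , b∈I , refl | _ , _ , rep≡inj₂ with representative-image (∈-image⁻ b∈I)
      ...   | _ , rep≡inj₁ with () ← trans (sym rep≡inj₁) rep≡inj₂

    length-S+[2s+1]≤2n : length S + (length image + suc (length image)) ≤ n + n
    length-S+[2s+1]≤2n =
      subst₂ (λ k l → length S + k ≤ l) length-R length-vertices (length-complement+length≤ R!)
      where
      length-R : length R ≡ length image + suc (length image)
      length-R = trans (length-++ (map representative image))
                       (cong₂ _+_ (length-map representative image)
                                  (cong suc (length-map inj₂ image)))

    ∈R⁻ : ∀ {v} → v ∈ R →
          (∃ λ b → b ∈ image × v ≡ representative b) ⊎ (∃ λ b → b ∈ c ∷ image × v ≡ inj₂ b)
    ∈R⁻ = Sum.map (∈-map⁻ representative) (∈-map⁻ inj₂) ∘ ∈-++⁻ (map representative image)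

    nonRepresentative∉R : ∀ {a} → inj₁ a ≢ representative (g a) → inj₁ a ∉ R
    nonRepresentative∉R {a} a-nonrep a∈R with ∈R⁻ a∈R
    ... | inj₁ (b , _ , a-rep) =
      a-nonrep (subst (λ b → inj₁ a ≡ representative b) (sym (representative-inj₁ a-rep)) a-rep)
    ... | inj₂ (_ , _ , ())

    outsideImage∉R : ∀ {b} → ¬ InImage b → b ≢ c → inj₂ b ∉ R
    outsideImage∉R {b} b∉I b≢c b∈R with ∈R⁻ b∈R
    ... | inj₁ (b′ , b′∈I , b-rep) with representative-image (∈-image⁻ b′∈I)
    ...   | _ , rep≡inj₁ with () ← trans b-rep rep≡inj₁
    outsideImage∉R b∉I b≢c _ | inj₂ (_ , here refl , refl)  = b≢c refl
    outsideImage∉R b∉I b≢c _ | inj₂ (_ , there b∈I , refl) = b∉I (∈-image⁻ b∈I)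

    module _ (2≤fiber : ∀ {b} → InImage b → 2 ≤ length (fiber b))
             (otherImagePoint : ∀ b → ∃ λ b′ → InImage b′ × b′ ≢ b)
             (σ : Automorphism H) (σ-fixes : ∀ v → v ∉ R → aut σ v ≡ v) where

      open Equivalence using (to; from)

      fixedFiberPoint : ∀ {b} → InImage b →
                        ∃ λ y → g y ≡ b × inj₁ y ≢ representative b × aut σ (inj₁ y) ≡ inj₁ y
      fixedFiberPoint b∈I with nonRepresentative b∈I (2≤fiber b∈I)
      ... | y , refl , y-nonrep = y , refl , y-nonrep , σ-fixes _ (nonRepresentative∉R y-nonrep)

      -- inj₂ b is the only vertex of B adjacent to the fixed inj₁ y, and the A-vertices other
      -- than the fixed inj₁ y′ of another fibre are adjacent to inj₁ y′ while inj₂ b is not.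
      image-fixed : ∀ {b} → InImage b → aut σ (inj₂ b) ≡ inj₂ b
      image-fixed {b} b∈I with fixedFiberPoint b∈I | otherImagePoint b
      ... | y , gy≡b , _ , σy | b′ , b′∈I , b′≢b with fixedFiberPoint b′∈I
      ... | y′ , gy′≡b′ , _ , σy′ with aut σ (inj₂ b) in σb
      ... | inj₂ b″ = cong inj₂ (trans (sym (to (Adj-transport σ σb σy) gy≡b)) gy≡b)
      ... | inj₁ a with a ≟ᶠ y′
      ...   | yes refl with () ← aut-injective σ (trans σb (sym σy′))
      ...   | no a≢y′ =
        ⊥-elim (b′≢b (trans (sym gy′≡b′) (from (Adj-transport σ σb σy′) a≢y′)))

      representative-fixed : ∀ {a} → inj₁ a ≡ representative (g a) → aut σ (inj₁ a) ≡ inj₁ a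
      representative-fixed {a} a-rep with fixedFiberPoint (a , refl)
      ... | y , gy≡ga , y-nonrep , σy with aut σ (inj₁ a) in σa
      ... | inj₂ b = ⊥-elim (to (Adj-transport σ σa σga) refl (trans (sym gy≡b) gy≡ga))
        where
        σga : aut σ (inj₂ (g a)) ≡ inj₂ (g a)
        σga = image-fixed (a , refl)
        a≢y : a ≢ y
        a≢y refl = y-nonrep a-rep
        gy≡b : g y ≡ b
        gy≡b = to (Adj-transport σ σa σy) a≢y
      ... | inj₁ a′ with a′ ≟ᶠ a
      ...   | yes a′≡a = cong inj₁ a′≡a
      ...   | no a′≢a  =
        ⊥-elim (a′≢a (inj₁-injective (aut-injective σ (trans (σ-fixes _ a′∉R) (sym σa)))))
        where
        ga′≡ga : g a′ ≡ g a
        ga′≡ga = to (Adj-transport σ σa (image-fixed (a , refl))) refl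
        a′∉R : inj₁ a′ ∉ R
        a′∉R = nonRepresentative∉R λ a′-rep →
          a′≢a (inj₁-injective (trans a′-rep (trans (cong representative ga′≡ga) (sym a-rep))))

      fixedUnless-c : ∀ v → v ≢ inj₂ c → aut σ v ≡ v
      fixedUnless-c (inj₁ a) _ with inj₁ a ≟ᵥ representative (g a)
      ... | yes a-rep   = representative-fixed a-rep
      ... | no a-nonrep = σ-fixes _ (nonRepresentative∉R a-nonrep)
      fixedUnless-c (inj₂ b) b≢c with any? (λ a → g a ≟ᶠ b)
      ... | yes b∈I = image-fixed b∈I
      ... | no b∉I  = σ-fixes _ (outsideImage∉R b∉I (b≢c ∘ cong inj₂))

    S-fixing : (∀ {b} → InImage b → 2 ≤ length (fiber b)) →
               (∀ b → ∃ λ b′ → InImage b′ × b′ ≢ b) →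
               IsFixingSet H S
    S-fixing 2≤fiber otherImagePoint σ fixes-S =
      fixesAllButOne⇒fixesAll σ _≟ᵥ_ (inj₂ c)
        (fixedUnless-c 2≤fiber otherImagePoint σ λ v v∉R → fixes-S v (∈-complement⁺ v∉R))

mainTheorem11 : (n : ℕ) → 3 ≤ n → (g : Fin n → Fin n)
    → 2 < imageSize g → imageSize g < n
    → (∀ b → ∃ (λ a → g a ≡ b) → preimageSize g b * imageSize g ≡ n)
    → FixingNumber (FunctigraphK n g) (2 * (n ∸ imageSize g) ∸ 1)
-- The hypothesis 3 ≤ n is implied by 2 < s < n.
mainTheorem11 n _ g 2<s s<n fiberSize = (S , S! , length-S , S-fixed) , minimal
  where
  open Functigraph n g
  s = imageSize g
  open Complement (proj₁ (nonImagePoint s<n)) (proj₂ (nonImagePoint s<n))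

  2≤fiber : ∀ {b} → InImage b → 2 ≤ length (fiber b)
  2≤fiber {b} b∈I = n<m*n⇒2≤m (preimageSize g b) s (subst (s <_) (sym (fiberSize b b∈I)) s<n)

  otherImagePoint : ∀ b → ∃ λ b′ → InImage b′ × b′ ≢ b
  otherImagePoint b with otherMember _≟ᶠ_ image! (<⇒≤ 2<s) b
  ... | b′ , b′∈I , b′≢b = b′ , ∈-image⁻ b′∈I , b′≢b

  S-fixed : IsFixingSet H S
  S-fixed = S-fixing 2≤fiber otherImagePoint

  count : 2 * (n ∸ s) ∸ 1 + (s + suc s) ≡ n + n
  count = 2*[n∸s]∸1+[s+1+s]≡n+n s<n

  length-S : length S ≡ 2 * (n ∸ s) ∸ 1
  length-S = +-cancelʳ-≡ _ _ _
    (trans (≤-antisym length-S+[2s+1]≤2n (fixingSet-length≥2n∸[2s+1] S S-fixed)) (sym count))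

  minimal : ∀ S′ → Unique S′ → IsFixingSet H S′ → 2 * (n ∸ s) ∸ 1 ≤ length S′
  minimal S′ _ S′-fixing = +-cancelʳ-≤ _ _ _
    (subst (_≤ length S′ + (s + suc s)) (sym count) (fixingSet-length≥2n∸[2s+1] S′ S′-fixing))
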